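{- Let $c:\mathbb{N}\to\mathbb{N}$ be a surjective colouring of the vertices of the board $K^{\aleph_0}$ (vertex set $\mathbb{N}$, all pairs as edges) such that $|c^{ -1}(i)|=\aleph_0$ for every $i\in\mathbb{N}$. In the Maker–Breaker game on this board, Breaker has a strategy which ensures that, after all turns have been played, for every complete subgraph $K$ of Maker's graph $G_M$ on countably infinitely many vertices, the set of colours $i\in\mathbb{N}$ such that $K$ contains infinitely many vertices of colour $i$ is not cofinite in $\mathbb{N}$.
   Context: Maker–Breaker game: Maker and Breaker alternately claim one previously unclaimed edge of the board per turn; the game lasts $\omega$ turns; $G_M$ is the graph of edges claimed by Maker. The colouring $c$ is fixed and known before the game starts. -}

module Defs where

open import Data.Nat using (ℕ; _≤_; _<_; _*_; suc)
open import Data.Product using (Σ; ∃; _×_; _,_)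
open import Data.Sum using (_⊎_)
open import Data.List using (List; map; upTo)
open import Relation.Binary.PropositionalEquality using (_≡_; _≢_)
open import Relation.Nullary using (¬_)
open import Function.Definitions using (Injective)

-- Board K^{ℵ₀}: vertex set ℕ, every pair {u,v} (u ≢ v) is an edge.
-- A move names an edge by an (unordered) pair of vertices.
Move : Set
Move = ℕ × ℕ

SameEdge : Move → Move → Set
SameEdge (u , v) (u' , v') = (u ≡ u' × v ≡ v') ⊎ (u ≡ v' × v ≡ u')

-- A play: the sequence of all moves, indexed by global move number.
-- Maker moves at even indices 2t, Breaker at odd indices 2t+1 (Maker starts).
Play : Set
Play = ℕ → Move

history : Play → ℕ → List Move
history p n = map p (upTo n)

Legal : Play → ℕ → Set
Legal p t = let (u , v) = p t in
  (u ≢ v) × (∀ s → s < t → ¬ SameEdge (p s) (p t))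

BreakerStrategy : Set
BreakerStrategy = List Move → Move

Follows : BreakerStrategy → Play → Set
Follows σ p = ∀ t → p (suc (2 * t)) ≡ σ (history p (suc (2 * t)))

MakerEdge : Play → ℕ → ℕ → Set
MakerEdge p u v = ∃ λ t → SameEdge (p (2 * t)) (u , v)

Surjective : (ℕ → ℕ) → Set
Surjective c = ∀ i → ∃ λ v → c v ≡ i

InfiniteClasses : (ℕ → ℕ) → Set
InfiniteClasses c = ∀ i n → ∃ λ v → n ≤ v × c v ≡ i

-- A complete subgraph of G_M on countably infinitely many vertices,
-- given by an injective enumeration f of its vertex set.
InfiniteClique : Play → (ℕ → ℕ) → Set
InfiniteClique p f = Injective _≡_ _≡_ f × (∀ m n → m ≢ n → MakerEdge p (f m) (f n))

InfManyOfColour : (ℕ → ℕ) → (ℕ → ℕ) → ℕ → Set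
InfManyOfColour c f i = ∀ n → ∃ λ m → n ≤ f m × c (f m) ≡ i

Cofinite : (ℕ → Set) → Set
Cofinite S = ∃ λ N → ∀ i → N ≤ i → S i

-- Give every colour i a designated pair of vertices, chosen so that every pair is designated
-- by infinitely many colours. Whenever Maker claims {x, w} with x < w and x in the pair
-- {a, b} designated by c w, Breaker claims the edge from the other vertex of that pair to w
-- (or any fresh edge, if that one is taken). Hence no vertex w is joined in G_M to both
-- vertices of the pair designated by its colour, when both lie below w. If an infinite clique
-- f had cofinitely many colours of infinite multiplicity, one of them would designate
-- {f 0, f 1}, and the clique would contain a vertex w of that colour above f 0 + f 1: a
-- contradiction, since w is joined to both f 0 and f 1.
module Submission where

open import Defs
open import Data.Nat using (ℕ; zero; suc; _+_; _*_; _≤_; _<_; _⊔_; _⊓_; z≤n; s≤s; _≟_)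
open import Data.Nat.Properties
open import Data.Product using (∃; _×_; _,_; proj₁; proj₂)
open import Data.Sum using (inj₁; inj₂)
open import Data.Empty using (⊥; ⊥-elim)
open import Data.Maybe as Maybe using (just; maybe′)
open import Data.List using (List; map; applyUpTo; upTo; last)
open import Data.List.Properties using (map-upTo; last-map)
open import Data.List.Extrema.Nat using (max; xs≤max)
open import Data.List.Relation.Unary.Any using (Any; any?)
open import Data.List.Relation.Unary.Any.Properties using (applyUpTo⁺; applyUpTo⁻)
import Data.List.Relation.Unary.All as All
open import Data.List.Relation.Unary.All.Properties using (All¬⇒¬Any; map⁻)
open import Relation.Nullary using (¬_; Dec; yes; no; ¬?)
open import Relation.Nullary.Decidable using (_×-dec_; _⊎-dec_)
open import Relation.Binary using (tri<; tri≈; tri>)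
open import Relation.Binary.PropositionalEquality
  using (_≡_; _≢_; refl; sym; trans; cong; subst; module ≡-Reasoning)

-- Enumeration of ℕ × ℕ along the anti-diagonals x + y = s, from (0 , s) down to (s , 0).
cantor-next : ℕ × ℕ → ℕ × ℕ
cantor-next (x , zero)  = (0 , suc x)
cantor-next (x , suc y) = (suc x , y)

cantor : ℕ → ℕ × ℕ
cantor zero    = (0 , 0)
cantor (suc n) = cantor-next (cantor n)

cantor-walk : ∀ k {n x y} → cantor n ≡ (x , k + y) → cantor (k + n) ≡ (k + x , y)
cantor-walk zero    eq = eq
cantor-walk (suc k) {x = x} {y} eq =
  cong cantor-next (cantor-walk k (trans eq (cong (x ,_) (sym (+-suc k y)))))

cantor-diagonal : ∀ s → ∃ λ n → cantor n ≡ (0 , s)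
cantor-diagonal zero = 0 , refl
cantor-diagonal (suc s) with cantor-diagonal s
... | n , eq = suc (s + n) , (begin
    cantor-next (cantor (s + n)) ≡⟨ cong cantor-next (cantor-walk s eq′) ⟩
    (0 , suc (s + 0))            ≡⟨ cong (λ z → (0 , suc z)) (+-identityʳ s) ⟩
    (0 , suc s)                  ∎)
  where
  open ≡-Reasoning
  eq′ : cantor n ≡ (0 , s + 0)
  eq′ = trans eq (cong (0 ,_) (sym (+-identityʳ s)))

cantor-surjective : ∀ q → ∃ λ n → cantor n ≡ q
cantor-surjective (a , b) with cantor-diagonal (a + b)
... | n , eq = a + n , trans (cantor-walk a eq) (cong (_, b) (+-identityʳ a))

cantor-sum≤ : ∀ n → proj₁ (cantor n) + proj₂ (cantor n) ≤ n
cantor-sum≤ zero = z≤n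
cantor-sum≤ (suc n) with cantor n | cantor-sum≤ n
... | (x , zero)  | h = s≤s (subst (_≤ n) (+-identityʳ x) h)
... | (x , suc y) | h = s≤s (≤-trans (+-monoʳ-≤ x (n≤1+n y)) h)

cantor-proj₂≤ : ∀ n → proj₂ (cantor n) ≤ n
cantor-proj₂≤ n = ≤-trans (m≤n+m _ _) (cantor-sum≤ n)

Recurrent : ∀ {A : Set} → (ℕ → A) → Set
Recurrent {A} s = ∀ (a : A) N → ∃ λ j → N ≤ j × s j ≡ a

surjective∘cantor-recurrent : ∀ {A : Set} (s : ℕ → A) → (∀ a → ∃ λ n → s n ≡ a) →
                              Recurrent (λ j → s (proj₁ (cantor j)))
surjective∘cantor-recurrent s s-surj a N with s-surj a
... | n , sn≡a with cantor-surjective (n , N)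
...   | j , cj≡nN =
  j , subst (λ q → proj₂ q ≤ j) cj≡nN (cantor-proj₂≤ j) , trans (cong (λ q → s (proj₁ q)) cj≡nN) sn≡a

designated : ℕ → ℕ × ℕ
designated i = cantor (proj₁ (cantor i))

designated-recurrent : Recurrent designated
designated-recurrent = surjective∘cantor-recurrent cantor cantor-surjective

partner : ℕ × ℕ → ℕ → ℕ
partner (a , b) x with x ≟ a
... | yes _ = b
... | no  _ = a

partner-fst : ∀ a b → partner (a , b) a ≡ b
partner-fst a b with a ≟ a
... | yes _   = refl
... | no  a≢a = ⊥-elim (a≢a refl)

partner-snd : ∀ {a b} → a ≢ b → partner (a , b) b ≡ a
partner-snd {a} {b} a≢b with b ≟ a
... | yes b≡a = ⊥-elim (a≢b (sym b≡a))
... | no  _   = refl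

SameEdge-sym : ∀ {m m'} → SameEdge m m' → SameEdge m' m
SameEdge-sym (inj₁ (refl , refl)) = inj₁ (refl , refl)
SameEdge-sym (inj₂ (refl , refl)) = inj₂ (refl , refl)

SameEdge-trans : ∀ {m₁ m₂ m₃} → SameEdge m₁ m₂ → SameEdge m₂ m₃ → SameEdge m₁ m₃
SameEdge-trans (inj₁ (refl , refl)) s                    = s
SameEdge-trans (inj₂ (refl , refl)) (inj₁ (refl , refl)) = inj₂ (refl , refl)
SameEdge-trans (inj₂ (refl , refl)) (inj₂ (refl , refl)) = inj₁ (refl , refl)

SameEdge? : ∀ m m' → Dec (SameEdge m m')
SameEdge? (u , v) (u' , v') = ((u ≟ u') ×-dec (v ≟ v')) ⊎-dec ((u ≟ v') ×-dec (v ≟ u'))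

SameEdge-commonEnd : ∀ {a b w} → SameEdge (a , w) (b , w) → a ≡ b
SameEdge-commonEnd (inj₁ (a≡b , _))   = a≡b
SameEdge-commonEnd (inj₂ (a≡w , w≡b)) = trans a≡w w≡b

endpointSum : Move → ℕ
endpointSum (u , v) = u + v

SameEdge-endpoint≤ : ∀ {m x y} → SameEdge m (x , y) → x ≤ endpointSum m
SameEdge-endpoint≤ (inj₁ (refl , refl)) = m≤m+n _ _
SameEdge-endpoint≤ (inj₂ (refl , refl)) = m≤n+m _ _

Claimed : List Move → Move → Set
Claimed h m = Any (λ m' → SameEdge m' m) h

LegalAfter : List Move → Move → Set
LegalAfter h m = (proj₁ m ≢ proj₂ m) × ¬ Claimed h m

LegalAfter? : ∀ h m → Dec (LegalAfter h m)
LegalAfter? h m = ¬? (proj₁ m ≟ proj₂ m) ×-dec ¬? (any? (λ m' → SameEdge? m' m) h)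

history⁺ : ∀ {P : Move → Set} (p : Play) {s T} → s < T → P (p s) → Any P (history p T)
history⁺ {P} p {T = T} s<T Pps = subst (Any P) (sym (map-upTo p T)) (applyUpTo⁺ p Pps s<T)

history⁻ : ∀ {P : Move → Set} (p : Play) {T} → Any P (history p T) → ∃ λ s → s < T × P (p s)
history⁻ {P} p {T} a = applyUpTo⁻ p (subst (Any P) (map-upTo p T) a)

legalAfter-history : ∀ (p : Play) T → LegalAfter (history p T) (p T) → Legal p T
legalAfter-history p T (u≢v , unclaimed) = u≢v , λ s s<T same → unclaimed (history⁺ p s<T same)

last-applyUpTo : ∀ {A : Set} (f : ℕ → A) n → last (applyUpTo f (suc n)) ≡ just (f n)
last-applyUpTo f zero    = refl
last-applyUpTo f (suc n) = last-applyUpTo (λ i → f (suc i)) n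

last-history : ∀ (p : Play) n → last (history p (suc n)) ≡ just (p n)
last-history p n = trans (last-map p (upTo (suc n))) (cong (Maybe.map p) (last-applyUpTo (λ i → i) n))

-- Breaker reacts at the larger endpoint, so the answer does not depend on how Maker orders the edge.
response : (ℕ → ℕ) → Move → Move
response c (u , v) = (partner (designated (c (u ⊔ v))) (u ⊓ v) , u ⊔ v)

response-SameEdge : ∀ c {m x w} → SameEdge m (x , w) → x ≤ w →
                    response c m ≡ (partner (designated (c w)) x , w)
response-SameEdge c (inj₁ (refl , refl)) x≤w rewrite m≤n⇒m⊔n≡n x≤w | m≤n⇒m⊓n≡m x≤w = refl
response-SameEdge c (inj₂ (refl , refl)) x≤w rewrite m≥n⇒m⊔n≡m x≤w | m≥n⇒m⊓n≡n x≤w = refl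

intended : (ℕ → ℕ) → List Move → Move
intended c h = maybe′ (response c) (0 , 0) (last h)

freshEdge : List Move → Move
freshEdge h = (suc B , suc (suc B))
  where B = max 0 (map endpointSum h)

freshEdge-legal : ∀ h → LegalAfter h (freshEdge h)
freshEdge-legal h = <⇒≢ (n<1+n _) , All¬⇒¬Any (All.map below (map⁻ (xs≤max 0 (map endpointSum h))))
  where
  below : ∀ {m} → endpointSum m ≤ max 0 (map endpointSum h) → ¬ SameEdge m (freshEdge h)
  below m≤B same = 1+n≰n (≤-trans (SameEdge-endpoint≤ same) m≤B)

breaker : (ℕ → ℕ) → BreakerStrategy
breaker c h with LegalAfter? h (intended c h)
... | yes _ = intended c h
... | no  _ = freshEdge h

breaker-legalAfter : ∀ c h → LegalAfter h (breaker c h)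
breaker-legalAfter c h with LegalAfter? h (intended c h)
... | yes legal = legal
... | no  _     = freshEdge-legal h

breaker-intended : ∀ c h → LegalAfter h (intended c h) → breaker c h ≡ intended c h
breaker-intended c h legal with LegalAfter? h (intended c h)
... | yes _       = refl
... | no  illegal = ⊥-elim (illegal legal)

breaker-legal : ∀ c (p : Play) → Follows (breaker c) p → ∀ t → Legal p (suc (2 * t))
breaker-legal c p follows t = legalAfter-history p T
  (subst (LegalAfter (history p T)) (sym (follows t)) (breaker-legalAfter c (history p T)))
  where T = suc (2 * t)

module _ (c : ℕ → ℕ) (p : Play) (follows : Follows (breaker c) p) where

  intended-afterMaker : ∀ t {x w} → SameEdge (p (2 * t)) (x , w) → x ≤ w →
                        intended c (history p (suc (2 * t))) ≡ (partner (designated (c w)) x , w)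
  intended-afterMaker t same x≤w =
    trans (cong (maybe′ (response c) (0 , 0)) (last-history p (2 * t))) (response-SameEdge c same x≤w)

  response-claimed : ∀ t {x y w} → SameEdge (p (2 * t)) (x , w) → x < w →
                     partner (designated (c w)) x ≡ y → y < w →
                     ∃ λ s → s ≤ suc (2 * t) × SameEdge (p s) (y , w)
  response-claimed t {x} {y} {w} same x<w partner≡y y<w
    with any? (λ m → SameEdge? m (y , w)) (history p (suc (2 * t)))
  ... | yes claimed = let s , s<T , same' = history⁻ p claimed in s , <⇒≤ s<T , same'
  ... | no  unclaimed =
    suc (2 * t) , ≤-refl , subst (λ m → SameEdge m (y , w)) (sym played) (inj₁ (refl , refl))
    where
    h = history p (suc (2 * t))
    intended≡ : intended c h ≡ (y , w)
    intended≡ = trans (intended-afterMaker t same (<⇒≤ x<w)) (cong (_, w) partner≡y)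
    played : p (suc (2 * t)) ≡ (y , w)
    played = begin
      p (suc (2 * t)) ≡⟨ follows t ⟩
      breaker c h     ≡⟨ breaker-intended c h (subst (LegalAfter h) (sym intended≡) (<⇒≢ y<w , unclaimed)) ⟩
      intended c h    ≡⟨ intended≡ ⟩
      (y , w)         ∎
      where open ≡-Reasoning

  module _ (makerLegal : ∀ t → Legal p (2 * t)) where

    response-blocksMaker : ∀ {t₁ t₂ x y w} → t₁ < t₂ → SameEdge (p (2 * t₁)) (x , w) → x < w →
                           partner (designated (c w)) x ≡ y → y < w → ¬ SameEdge (p (2 * t₂)) (y , w)
    response-blocksMaker {t₁} {t₂} t₁<t₂ same₁ x<w partner≡y y<w same₂
      with response-claimed t₁ same₁ x<w partner≡y y<w
    ... | s , s≤T , same =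
      proj₂ (makerLegal t₂) s (≤-<-trans s≤T breakerTurn<makerTurn) (SameEdge-trans same (SameEdge-sym same₂))
      where
      breakerTurn<makerTurn : suc (2 * t₁) < 2 * t₂
      breakerTurn<makerTurn = subst (_≤ 2 * t₂) (*-suc 2 t₁) (*-monoʳ-≤ 2 t₁<t₂)

    no-fork : ∀ {a b w} → a ≢ b → a < w → b < w → designated (c w) ≡ (a , b) →
              MakerEdge p a w → MakerEdge p b w → ⊥
    no-fork {a} {b} {w} a≢b a<w b<w d≡ab (t₁ , same₁) (t₂ , same₂) with <-cmp t₁ t₂
    ... | tri< t₁<t₂ _ _ = response-blocksMaker t₁<t₂ same₁ a<w partner-a b<w same₂
      where
      partner-a : partner (designated (c w)) a ≡ b
      partner-a = trans (cong (λ q → partner q a) d≡ab) (partner-fst a b)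
    ... | tri> _ _ t₂<t₁ = response-blocksMaker t₂<t₁ same₂ b<w partner-b a<w same₁
      where
      partner-b : partner (designated (c w)) b ≡ a
      partner-b = trans (cong (λ q → partner q b) d≡ab) (partner-snd a≢b)
    ... | tri≈ _ refl _ = a≢b (SameEdge-commonEnd (SameEdge-trans (SameEdge-sym same₁) same₂))

    clique-missesColours : ∀ f → InfiniteClique p f → ¬ Cofinite (InfManyOfColour c f)
    clique-missesColours f (f-injective , edge) (N , infinitelyMany)
      with designated-recurrent (f 0 , f 1) N
    ... | i , N≤i , dᵢ with infinitelyMany i N≤i (suc (f 0 + f 1))
    ... | m , above , c[fm]≡i =
      no-fork f0≢f1 f0<fm f1<fm (trans (cong designated c[fm]≡i) dᵢ)
              (edge 0 m (λ 0≡m → <-irrefl (cong f 0≡m) f0<fm))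
              (edge 1 m (λ 1≡m → <-irrefl (cong f 1≡m) f1<fm))
      where
      f0≢f1 : f 0 ≢ f 1
      f0≢f1 eq = 0≢1+n (f-injective eq)
      f0<fm : f 0 < f m
      f0<fm = ≤-trans (s≤s (m≤m+n _ _)) above
      f1<fm : f 1 < f m
      f1<fm = ≤-trans (s≤s (m≤n+m _ _)) above

mainTheorem6 : (c : ℕ → ℕ) → Surjective c → InfiniteClasses c →
    ∃ λ (σ : BreakerStrategy) → (p : Play) → Follows σ p →
      (∀ t → Legal p (2 * t)) →
      (∀ t → Legal p (suc (2 * t)))
      × (∀ (f : ℕ → ℕ) → InfiniteClique p f →
           ¬ Cofinite (InfManyOfColour c f))
mainTheorem6 c _ _ = breaker c , λ p follows makerLegal →
  breaker-legal c p follows , clique-missesColours c p follows makerLegal
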